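{- Let $G$ be a connected graph and let $\mathrm{Forb\text{ - }con}(G)$ be the class of graphs $M$ such that no connected component of $M$ is isomorphic to $G$. For $M,N\in\mathrm{Forb\text{ - }con}(G)$ define $M\preceq N$ iff $M$ is an induced subgraph of $N$ and every connected component $C$ of $M$ which is embeddable in $G$ is a connected component of $N$. Then the following strong coherence holds: if $M_0,M_1,M_2\in\mathrm{Forb\text{ - }con}(G)$, $M_0\subseteq M_1\subseteq M_2$ (as induced subgraphs) and $M_0\preceq M_2$, then $M_0\preceq M_1$.
   Context: A graph is a structure $(V,E)$ with $E$ an irreflexive symmetric binary relation; "embeddable in $G$" means isomorphic to an induced subgraph of $G$. -}

module Defs where

open import Data.Product using (Σ; ∃; _×_; _,_; proj₁)
open import Relation.Nullary using (¬_)
open import Relation.Binary.PropositionalEquality using (_≡_)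

record Graph : Set₁ where
  field
    V     : Set
    E     : V → V → Set
    irrefl : ∀ x → ¬ E x x
    sym    : ∀ {x y} → E x y → E y x
open Graph public

data Reach (M : Graph) (x : V M) : V M → Set where
  here : Reach M x x
  step : ∀ {y z} → Reach M x y → E M y z → Reach M x z

Connected : Graph → Set
Connected G = V G × (∀ x y → Reach G x y)

Comp : (M : Graph) → V M → Graph
Comp M x = record
  { V = Σ (V M) (Reach M x)
  ; E = λ a b → E M (proj₁ a) (proj₁ b)
  ; irrefl = λ a → irrefl M (proj₁ a)
  ; sym = sym M
  }

record Emb (M N : Graph) : Set where
  field
    fun   : V M → V N
    inj   : ∀ {x y} → fun x ≡ fun y → x ≡ y
    pres  : ∀ {x y} → E M x y → E N (fun x) (fun y)
    refl' : ∀ {x y} → E N (fun x) (fun y) → E M x y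
open Emb public

_∘ₑ_ : ∀ {L M N} → Emb M N → Emb L M → Emb L N
g ∘ₑ f = record
  { fun = λ x → fun g (fun f x)
  ; inj = λ p → inj f (inj g p)
  ; pres = λ e → pres g (pres f e)
  ; refl' = λ e → refl' f (refl' g e)
  }

record Iso (M N : Graph) : Set where
  field
    to      : V M → V N
    from    : V N → V M
    from-to : ∀ x → from (to x) ≡ x
    to-from : ∀ y → to (from y) ≡ y
    to-pres : ∀ {x y} → E M x y → E N (to x) (to y)
    to-refl : ∀ {x y} → E N (to x) (to y) → E M x y

Embeddable : Graph → Graph → Set
Embeddable C G = Emb C G

ForbCon : Graph → Graph → Set
ForbCon G M = ∀ (x : V M) → ¬ Iso (Comp M x) G

-- M ⪯ N along the induced-subgraph embedding f : every component of M
-- embeddable in G is (via f) a connected component of N, i.e. the image of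
-- the component is closed under reachability in N.
Prec : (G M N : Graph) → Emb M N → Set
Prec G M N f =
  ∀ (x : V M) → Embeddable (Comp M x) G →
  ∀ (y : V N) → Reach N (fun f x) y →
  ∃ λ (z : V M) → Reach M x z × fun f z ≡ y

module Submission where

open import Defs
open import Data.Product using (_,_)

Emb-reach : ∀ {M N} (g : Emb M N) {a b} → Reach M a b → Reach N (fun g a) (fun g b)
Emb-reach g here       = here
Emb-reach g (step r e) = step (Emb-reach g r) (pres g e)

Prec-cancelˡ : ∀ G {M₀ M₁ M₂} (f : Emb M₀ M₁) (g : Emb M₁ M₂) →
  Prec G M₀ M₂ (g ∘ₑ f) → Prec G M₀ M₁ f
Prec-cancelˡ G f g prec x x-emb y x↝y
  with prec x x-emb (fun g y) (Emb-reach g x↝y)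
... | z , x↝z , gfz≡gy = z , x↝z , inj g gfz≡gy

mainTheorem12 : (G : Graph) → Connected G →
    (M₀ M₁ M₂ : Graph) → ForbCon G M₀ → ForbCon G M₁ → ForbCon G M₂ →
    (f : Emb M₀ M₁) (g : Emb M₁ M₂) →
    Prec G M₀ M₂ (g ∘ₑ f) → Prec G M₀ M₁ f
mainTheorem12 G _ _ _ _ _ _ _ = Prec-cancelˡ G
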